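{- Let $b\ge 2$ be an integer and let $\alpha\in[0,1)$ be such that its base $b$ digit sequence is the concatenation $w_1w_2w_3\cdots$, where for each $j\ge1$ the word $w_j$ has length $b^j b^{b^j}$ and is a $b$-ary $(b^j,b^j)$-nested semi-perfect necklace. For every positive integer $m$ put $n_m:=\sum_{j=1}^{m-1} b^j b^{b^j}$. Then for every integer $t$ with $1\le t\le b^m$, every integer $B$ with $0\le B<b^{b^m-t}$, and every integer $c$ with $0\le c<b^t$, with the exception of at most $2b^m$ such $c$, we have $$\#\left\{(k,n)\;:\;0\le k<b^m,\ Bb^t\le n<Bb^t+b^t,\ \{b^{n_m+b^m n+k}\alpha\}\in\left[\tfrac{c}{b^t},\tfrac{c+1}{b^t}\right)\right\}=b^m.$$
   Context: $\{x\}$ denotes the fractional part of $x$. A necklace is a word considered up to rotation, so occurrences of subwords are counted circularly. A $b$-ary necklace is $(k,l)$-semi perfect if its length is $lb^k$ and each word of length $k$ over $\{0,\ldots,b-1\}$ occurs in it (circularly) exactly $l$ times. A $b$-ary word $w$ is a $(k,l)$-nested semi-perfect necklace if for each $j\in\{1,\ldots,k\}$, each block of $w$ of length $lb^j$ starting at a position congruent to $1$ modulo $lb^j$ is a $(j,l)$-semi perfect necklace. -}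

module Defs where

open import Data.Nat using (ℕ; zero; suc; _+_; _*_; _∸_; _^_; _≤_; _<_)
open import Data.Nat.DivMod using (_%_)
open import Data.Fin using (Fin; toℕ)
open import Data.Fin.Properties using () renaming (_≟_ to _≟F_)
open import Data.Vec using (Vec; tabulate)
open import Data.Vec.Properties using (≡-dec)
open import Data.List using (List; length; filter; upTo)
open import Data.List.Membership.Propositional using (_∈_)
open import Data.List.Relation.Unary.Unique.Propositional using (Unique)
open import Data.Product using (Σ; ∃; _×_)
open import Relation.Binary.PropositionalEquality using (_≡_)
open import Function.Bundles using (_⇔_)

-- A b-ary word of length len is represented by f : ℕ → Fin b, of which only
-- the values f 0, …, f (len - 1) are relevant (positions are 0-indexed here).

-- circular position: p mod len (len = 0 never arises with positions)
wrap : ℕ → ℕ → ℕ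
wrap zero p = p
wrap (suc n) p = p % suc n

subword : ∀ {b} → ℕ → (ℕ → Fin b) → ℕ → (k : ℕ) → Vec (Fin b) k
subword len f i k = tabulate (λ r → f (wrap len (i + toℕ r)))

occ : ∀ {b} → ℕ → (ℕ → Fin b) → ∀ {k} → Vec (Fin b) k → ℕ
occ len f {k} u = length (filter (λ i → ≡-dec _≟F_ (subword len f i k) u) (upTo len))

SemiPerfect : (b k l : ℕ) → (ℕ → Fin b) → Set
SemiPerfect b k l f = (u : Vec (Fin b) k) → occ (l * b ^ k) f u ≡ l

-- (k,l)-nested semi-perfect necklace (word of length l * b^k):
-- for each 1 ≤ j ≤ k, each block of length l b^j starting at (0-indexed)
-- position q * l b^j (i.e. 1-indexed position ≡ 1 mod l b^j) is (j,l)-semi perfect.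
NestedSemiPerfect : (b k l : ℕ) → (ℕ → Fin b) → Set
NestedSemiPerfect b k l f =
  ∀ j → 1 ≤ j → j ≤ k → ∀ q → suc q * (l * b ^ j) ≤ l * b ^ k →
  SemiPerfect b j l (λ i → f (q * (l * b ^ j) + i))

lenW : ℕ → ℕ → ℕ
lenW b j = b ^ j * b ^ (b ^ j)

partialLen : ℕ → ℕ → ℕ
partialLen b zero = 0
partialLen b (suc m) = partialLen b m + lenW b (suc m)

nIdx : ℕ → ℕ → ℕ
nIdx b m = partialLen b (m ∸ 1)

-- The base-b digits of α are d 0, d 1, d 2, … (d i is the (i+1)-st digit),
-- so {b^N α} = Σ_{i ≥ 1} d (N + i - 1) b^{-i}.
-- digVal b d N L = Σ_{i=0}^{L-1} d (N+i) b^{L-1-i}, so that digVal/b^L is the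
-- truncation of {b^N α} to L digits, and {b^N α} ≤ (digVal + 1)/b^L.
digVal : (b : ℕ) → (ℕ → Fin b) → ℕ → ℕ → ℕ
digVal b d N zero = 0
digVal b d N (suc L) = digVal b d N L * b + toℕ (d (N + L))

-- {b^N α} ∈ [c/b^t, (c+1)/b^t), expressed exactly in integer arithmetic:
--   c/b^t ≤ x      iff  ∀ L, c/b^t ≤ (digVal L + 1)/b^L
--   x < (c+1)/b^t  iff  ∃ L, (digVal L + 1)/b^L < (c+1)/b^t
InInterval : (b : ℕ) → (ℕ → Fin b) → (N t c : ℕ) → Set
InInterval b d N t c =
  (∀ L → c * b ^ L ≤ (digVal b d N L + 1) * b ^ t) ×
  (∃ λ L → (digVal b d N L + 1) * b ^ t < suc c * b ^ L)

HasCard : (ℕ × ℕ → Set) → ℕ → Set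
HasCard P n = Σ (List (ℕ × ℕ)) λ xs →
  Unique xs × (∀ x → (x ∈ xs) ⇔ P x) × length xs ≡ n

-- Put N = n_m + b^m n + k. Since α has infinitely many digits below b − 1, the number
-- {b^N α} lies in [c/b^t, (c+1)/b^t) exactly when the t digits of α following position N
-- spell c in base b. As (k, n) runs over the cell in question, N runs once over the positions
-- of the B-th block of length b^m b^t inside w_m, and by nestedness that block is a
-- (t, b^m)-semi-perfect necklace: each word of length t occurs b^m times among its circular
-- windows. A circular window agrees with the linear one at the same position unless it wraps
-- around the end of the block; the values of the t wrapping windows, read both ways, are the
-- at most 2t ≤ 2b^m exceptional values of c.
module Submission where

open import Defs
open import Data.Nat using (ℕ; zero; suc; _+_; _*_; _∸_; _^_; _≤_; _<_; _≟_; _≤?_; s≤s; s≤s⁻¹; z≤n; NonZero; >-nonZero; >-nonZero⁻¹)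
open import Data.Nat.Properties
open import Data.Nat.DivMod
open import Data.Nat.Tactic.RingSolver using (solve-∀)
import Data.Fin as Fin
open import Data.Fin using (Fin; toℕ; fromℕ<; funToFin; finToFun; combine)
open import Data.Fin.Properties using (toℕ<n; toℕ-combine; toℕ-injective; toℕ-fromℕ<; nonZeroIndex; funToFin-finToFin; finToFun-funToFin)
open import Data.Fin.Properties using () renaming (_≟_ to _≟F_)
open import Data.Vec using (Vec; []; _∷_; tabulate; lookup; head)
open import Data.Vec.Properties using (tabulate-cong; tabulate∘lookup; lookup∘tabulate; ≡-dec)
open import Data.List using (List; []; _∷_; length; filter; upTo; map; _++_)
open import Data.List.Properties using (length-map; length-++; length-upTo)
open import Data.List.Membership.Propositional using (_∈_; _∉_)
open import Data.List.Membership.Propositional.Properties using (∈-map⁺; ∈-map⁻; ∈-upTo⁺; ∈-upTo⁻; ∈-filter⁺; ∈-filter⁻; ∈-++⁺ˡ; ∈-++⁺ʳ)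
open import Data.List.Relation.Unary.Any using (here; there)
import Data.List.Relation.Unary.Unique.Propositional.Properties as Unique
open import Data.Product using (Σ; ∃; _,_; _×_; proj₁; proj₂)
open import Data.Sum using (inj₁; inj₂)
open import Data.Empty using (⊥-elim)
open import Relation.Unary using (Decidable)
open import Relation.Nullary using (yes; no)
open import Function.Base using (_∘_)
open import Function.Definitions using (Injective)
open import Function.Bundles using (_⇔_; mk⇔; Equivalence)
open import Relation.Binary.PropositionalEquality

m*o+r<n*o : ∀ {m n o r} → m < n → r < o → m * o + r < n * o
m*o+r<n*o {m} {n} {o} {r} m<n r<o = begin-strict
  m * o + r  <⟨ +-monoʳ-< (m * o) r<o ⟩
  m * o + o  ≡⟨ +-comm (m * o) o ⟩
  suc m * o  ≤⟨ *-monoˡ-≤ o m<n ⟩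
  n * o      ∎
  where open ≤-Reasoning

funToFin-cong : ∀ {m n} {f g : Fin m → Fin n} → (∀ r → f r ≡ g r) → funToFin f ≡ funToFin g
funToFin-cong {zero} f≗g = refl
funToFin-cong {suc m} f≗g = cong₂ combine (f≗g Fin.zero) (funToFin-cong (f≗g ∘ Fin.suc))

module Digits {b : ℕ} (d : ℕ → Fin b) where

  private
    *b^-mono-< : ∀ n {x y} → x < y → x * b ^ n < y * b ^ n
    *b^-mono-< n = *-monoˡ-< (b ^ n) {{m^n≢0 b n {{nonZeroIndex (d 0)}}}}

    *-^-+ : ∀ x t s → x * b ^ (t + s) ≡ x * b ^ s * b ^ t
    *-^-+ x t s = begin
      x * b ^ (t + s)      ≡⟨ cong (x *_) (^-distribˡ-+-* b t s) ⟩
      x * (b ^ t * b ^ s)  ≡⟨ cong (x *_) (*-comm (b ^ t) (b ^ s)) ⟩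
      x * (b ^ s * b ^ t)  ≡⟨ *-assoc x (b ^ s) (b ^ t) ⟨
      x * b ^ s * b ^ t    ∎
      where open ≡-Reasoning

  digVal-+ : ∀ N t s → digVal b d N (t + s) ≡ digVal b d N t * b ^ s + digVal b d (N + t) s
  digVal-+ N t zero = begin
    digVal b d N (t + 0)    ≡⟨ cong (digVal b d N) (+-identityʳ t) ⟩
    digVal b d N t          ≡⟨ *-identityʳ (digVal b d N t) ⟨
    digVal b d N t * 1      ≡⟨ +-identityʳ (digVal b d N t * 1) ⟨
    digVal b d N t * 1 + 0  ∎
    where open ≡-Reasoning
  digVal-+ N t (suc s) = begin
    digVal b d N (t + suc s)
      ≡⟨ cong (digVal b d N) (+-suc t s) ⟩
    digVal b d N (t + s) * b + toℕ (d (N + (t + s)))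
      ≡⟨ cong₂ (λ x p → x * b + toℕ (d p)) (digVal-+ N t s) (sym (+-assoc N t s)) ⟩
    (digVal b d N t * b ^ s + digVal b d (N + t) s) * b + toℕ (d (N + t + s))
      ≡⟨ shift (digVal b d N t) (b ^ s) (digVal b d (N + t) s) b (toℕ (d (N + t + s))) ⟩
    digVal b d N t * b ^ suc s + digVal b d (N + t) (suc s)
      ∎
    where
      open ≡-Reasoning
      shift : ∀ x p y q z → (x * p + y) * q + z ≡ x * (q * p) + (y * q + z)
      shift = solve-∀

  digVal< : ∀ N L → digVal b d N L < b ^ L
  digVal< N zero = s≤s z≤n
  digVal< N (suc L) = subst (digVal b d N (suc L) <_) (*-comm (b ^ L) b)
    (m*o+r<n*o (digVal< N L) (toℕ<n (d (N + L))))

  digVal*^<[digVal+1]*^ : ∀ N K L → digVal b d N K * b ^ L < (digVal b d N L + 1) * b ^ K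
  digVal*^<[digVal+1]*^ N K L with ≤-total K L
  ... | inj₁ K≤L with s , refl ← m≤n⇒∃[o]m+o≡n K≤L = begin-strict
    x * b ^ (K + s)                     ≡⟨ *-^-+ x K s ⟩
    x * b ^ s * b ^ K                   ≤⟨ *-monoˡ-≤ (b ^ K) (m≤m+n (x * b ^ s) r) ⟩
    (x * b ^ s + r) * b ^ K             <⟨ *b^-mono-< K (m<m+n (x * b ^ s + r) (s≤s z≤n)) ⟩
    (x * b ^ s + r + 1) * b ^ K         ≡⟨ cong (λ y → (y + 1) * b ^ K) (digVal-+ N K s) ⟨
    (digVal b d N (K + s) + 1) * b ^ K  ∎
    where
      open ≤-Reasoning
      x = digVal b d N K
      r = digVal b d (N + K) s
  ... | inj₂ L≤K with s , refl ← m≤n⇒∃[o]m+o≡n L≤K = begin-strict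
    digVal b d N (L + s) * b ^ L  ≡⟨ cong (_* b ^ L) (digVal-+ N L s) ⟩
    (y * b ^ s + r) * b ^ L       <⟨ *b^-mono-< L (m*o+r<n*o (m<m+n y (s≤s z≤n)) (digVal< (N + L) s)) ⟩
    (y + 1) * b ^ s * b ^ L       ≡⟨ *-^-+ (y + 1) L s ⟨
    (y + 1) * b ^ (L + s)         ∎
    where
      open ≤-Reasoning
      y = digVal b d N L
      r = digVal b d (N + L) s

  digVal-upper-strict : ∀ N t s → suc (digVal b d (N + t) s) < b ^ s →
                        (digVal b d N (t + s) + 1) * b ^ t < suc (digVal b d N t) * b ^ (t + s)
  digVal-upper-strict N t s tail< = begin-strict
    (digVal b d N (t + s) + 1) * b ^ t  ≡⟨ cong (λ y → (y + 1) * b ^ t) (digVal-+ N t s) ⟩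
    (x * b ^ s + r + 1) * b ^ t         ≡⟨ cong (_* b ^ t) (+-assoc (x * b ^ s) r 1) ⟩
    (x * b ^ s + (r + 1)) * b ^ t       <⟨ *b^-mono-< t (m*o+r<n*o (n<1+n x) (subst (_< b ^ s) (+-comm 1 r) tail<)) ⟩
    suc x * b ^ s * b ^ t               ≡⟨ *-^-+ (suc x) t s ⟨
    suc x * b ^ (t + s)                 ∎
    where
      open ≤-Reasoning
      x = digVal b d N t
      r = digVal b d (N + t) s

  digVal-nonMaximal : ∀ M s → suc (toℕ (d (M + s))) < b → suc (digVal b d M (suc s)) < b ^ suc s
  digVal-nonMaximal M s d< = begin-strict
    suc (digVal b d M s * b + toℕ (d (M + s)))  ≡⟨ +-suc (digVal b d M s * b) (toℕ (d (M + s))) ⟨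
    digVal b d M s * b + suc (toℕ (d (M + s)))  <⟨ m*o+r<n*o (digVal< M s) d< ⟩
    b ^ s * b                                   ≡⟨ *-comm (b ^ s) b ⟩
    b ^ suc s                                   ∎
    where open ≤-Reasoning

  NonMaximalDigitsRecur : Set
  NonMaximalDigitsRecur = ∀ M → ∃ λ p → M ≤ p × suc (toℕ (d p)) < b

  nonMaximal-tail : NonMaximalDigitsRecur → ∀ M → ∃ λ s → suc (digVal b d M s) < b ^ s
  nonMaximal-tail recur M with p , M≤p , d< ← recur M =
    suc (p ∸ M) , digVal-nonMaximal M (p ∸ M) (subst (λ q → suc (toℕ (d q)) < b) (sym (m+[n∸m]≡n M≤p)) d<)

  InInterval⇔digVal≡ : NonMaximalDigitsRecur → ∀ N t c → InInterval b d N t c ⇔ digVal b d N t ≡ c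
  InInterval⇔digVal≡ recur N t c with s , tail< ← nonMaximal-tail recur (N + t) = mk⇔ to from
    where
      to : InInterval b d N t c → digVal b d N t ≡ c
      to (lower , L , upper) = ≤-antisym
        (s≤s⁻¹ (*-cancelʳ-< (b ^ L) _ _ (<-trans (digVal*^<[digVal+1]*^ N t L) upper)))
        (s≤s⁻¹ (*-cancelʳ-< (b ^ (t + s)) _ _ (≤-<-trans (lower (t + s)) (digVal-upper-strict N t s tail<))))
      from : digVal b d N t ≡ c → InInterval b d N t c
      from refl = (λ L → <⇒≤ (digVal*^<[digVal+1]*^ N t L)) , t + s , digVal-upper-strict N t s tail<

  digVal-shift : ∀ {g : ℕ → Fin b} K → (∀ i → g i ≡ d (K + i)) → ∀ N L → digVal b g N L ≡ digVal b d (K + N) L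
  digVal-shift K g≗ N zero = refl
  digVal-shift K g≗ N (suc L) =
    cong₂ (λ x y → x * b + toℕ y) (digVal-shift K g≗ N L) (trans (g≗ (N + L)) (cong d (sym (+-assoc K N L))))

  toℕ-funToFin-digits : ∀ M t → toℕ (funToFin (λ (r : Fin t) → d (M + toℕ r))) ≡ digVal b d M t
  toℕ-funToFin-digits M zero = refl
  toℕ-funToFin-digits M (suc t) = begin
    toℕ (funToFin (λ (r : Fin (suc t)) → d (M + toℕ r)))
      ≡⟨ toℕ-combine (d (M + 0)) _ ⟩
    b ^ t * toℕ (d (M + 0)) + toℕ (funToFin (λ (r : Fin t) → d (M + suc (toℕ r))))
      ≡⟨ cong₂ _+_ (*-comm (b ^ t) _) (cong toℕ (funToFin-cong {m = t} (λ r → cong d (sym (+-assoc M 1 (toℕ r)))))) ⟩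
    toℕ (d (M + 0)) * b ^ t + toℕ (funToFin (λ (r : Fin t) → d (M + 1 + toℕ r)))
      ≡⟨ cong (toℕ (d (M + 0)) * b ^ t +_) (toℕ-funToFin-digits (M + 1) t) ⟩
    toℕ (d (M + 0)) * b ^ t + digVal b d (M + 1) t
      ≡⟨ digVal-+ M 1 t ⟨
    digVal b d M (suc t)
      ∎
    where open ≡-Reasoning

wordValue : ∀ {b t} → Vec (Fin b) t → ℕ
wordValue u = toℕ (funToFin (lookup u))

wordValue-tabulate : ∀ {b t} (f : Fin t → Fin b) → wordValue (tabulate f) ≡ toℕ (funToFin f)
wordValue-tabulate f = cong toℕ (funToFin-cong (lookup∘tabulate f))

wordValue-injective : ∀ {b t} {u v : Vec (Fin b) t} → wordValue u ≡ wordValue v → u ≡ v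
wordValue-injective {u = u} {v} eq = begin
  u                    ≡⟨ tabulate∘lookup u ⟨
  tabulate (lookup u)  ≡⟨ tabulate-cong lookup-u≗lookup-v ⟩
  tabulate (lookup v)  ≡⟨ tabulate∘lookup v ⟩
  v                    ∎
  where
    open ≡-Reasoning
    lookup-u≗lookup-v : ∀ r → lookup u r ≡ lookup v r
    lookup-u≗lookup-v r = begin
      lookup u r                        ≡⟨ finToFun-funToFin (lookup u) r ⟨
      finToFun (funToFin (lookup u)) r  ≡⟨ cong (λ x → finToFun x r) (toℕ-injective eq) ⟩
      finToFun (funToFin (lookup v)) r  ≡⟨ finToFun-funToFin (lookup v) r ⟩
      lookup v r                        ∎

wordValue-surjective : ∀ {b t c} → c < b ^ t → ∃ λ (u : Vec (Fin b) t) → wordValue u ≡ c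
wordValue-surjective {b} {t} {c} c< = tabulate digits , (begin
  wordValue (tabulate digits)  ≡⟨ wordValue-tabulate digits ⟩
  toℕ (funToFin digits)        ≡⟨ cong toℕ (funToFin-finToFin {t} {b} x) ⟩
  toℕ x                        ≡⟨ toℕ-fromℕ< c< ⟩
  c                            ∎)
  where
    open ≡-Reasoning
    x : Fin (b ^ t)
    x = fromℕ< c<
    digits : Fin t → Fin b
    digits = finToFun {b} {t} x

wrap-< : ∀ {L p} → p < L → wrap L p ≡ p
wrap-< {suc L} p< = m<n⇒m%n≡m p<

filter-≐-∈ : ∀ {A : Set} {P Q : A → Set} (P? : Decidable P) (Q? : Decidable Q) xs →
             (∀ {x} → x ∈ xs → P x ⇔ Q x) → filter P? xs ≡ filter Q? xs
filter-≐-∈ P? Q? [] P⇔Q = refl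
filter-≐-∈ P? Q? (x ∷ xs) P⇔Q with P? x | Q? x
... | yes _  | yes _  = cong (x ∷_) (filter-≐-∈ P? Q? xs (P⇔Q ∘ there))
... | no _   | no _   = filter-≐-∈ P? Q? xs (P⇔Q ∘ there)
... | yes px | no ¬qx = ⊥-elim (¬qx (Equivalence.to (P⇔Q (here refl)) px))
... | no ¬px | yes qx = ⊥-elim (¬px (Equivalence.from (P⇔Q (here refl)) qx))

filter-nonEmpty : ∀ {A : Set} {P : A → Set} (P? : Decidable P) xs → 0 < length (filter P? xs) → ∃ P
filter-nonEmpty P? (x ∷ xs) nonEmpty with P? x
... | yes px = x , px
... | no _   = filter-nonEmpty P? xs nonEmpty

HasCard-map-filter : ∀ {P : ℕ × ℕ → Set} {Q : ℕ → Set} (Q? : Decidable Q) {f : ℕ → ℕ × ℕ} →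
                     Injective _≡_ _≡_ f → ∀ L → (∀ x → P x ⇔ ∃ λ i → i < L × Q i × f i ≡ x) →
                     HasCard P (length (filter Q? (upTo L)))
HasCard-map-filter {P} Q? {f} f-injective L P⇔ =
  map f (filter Q? (upTo L)) , Unique.map⁺ f-injective (Unique.filter⁺ Q? (Unique.upTo⁺ L)) ,
  (λ x → mk⇔ (to x) (from x)) , length-map f (filter Q? (upTo L))
  where
    to : ∀ x → x ∈ map f (filter Q? (upTo L)) → P x
    to x x∈ with i , i∈ , refl ← ∈-map⁻ f x∈ with i∈upTo , Qi ← ∈-filter⁻ Q? {xs = upTo L} i∈ =
      Equivalence.from (P⇔ x) (i , ∈-upTo⁻ i∈upTo , Qi , refl)
    from : ∀ x → P x → x ∈ map f (filter Q? (upTo L))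
    from x Px with i , i<L , Qi , refl ← Equivalence.to (P⇔ x) Px =
      ∈-map⁺ f (∈-filter⁺ Q? (∈-upTo⁺ i<L) Qi)

SemiPerfect-occurs : ∀ {b k l f} → 0 < l → SemiPerfect b k l f → ∀ u → ∃ λ i → subword (l * b ^ k) f i k ≡ u
SemiPerfect-occurs {b} {k} {l} {f} l>0 semiPerfect u =
  filter-nonEmpty (λ i → ≡-dec _≟F_ (subword (l * b ^ k) f i k) u) (upTo (l * b ^ k))
                  (subst (0 <_) (sym (semiPerfect u)) l>0)

module Windows {b : ℕ} (g : ℕ → Fin b) (t l : ℕ) where

  private
    L : ℕ
    L = l * b ^ t

  wrappingStarts : List ℕ
  wrappingStarts = map (L ∸ t +_) (upTo t)

  ∈-wrappingStarts : ∀ {i} → i < L → L < i + t → i ∈ wrappingStarts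
  ∈-wrappingStarts {i} i<L L<i+t =
    subst (_∈ wrappingStarts) (m+[n∸m]≡n L∸t≤i) (∈-map⁺ (L ∸ t +_) (∈-upTo⁺ i∸[L∸t]<t))
    where
      L∸t≤i : L ∸ t ≤ i
      L∸t≤i = ≤-trans (∸-monoˡ-≤ t (<⇒≤ L<i+t)) (≤-reflexive (m+n∸n≡m i t))
      i∸[L∸t]<t : i ∸ (L ∸ t) < t
      i∸[L∸t]<t = +-cancelˡ-< (L ∸ t) _ _ (begin-strict
        L ∸ t + (i ∸ (L ∸ t))  ≡⟨ m+[n∸m]≡n L∸t≤i ⟩
        i                      <⟨ i<L ⟩
        L                      ≤⟨ m≤n+m∸n L t ⟩
        t + (L ∸ t)            ≡⟨ +-comm t (L ∸ t) ⟩
        L ∸ t + t              ∎)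
        where open ≤-Reasoning

  -- A window wrapping around the end of the block is read circularly by the necklace but
  -- linearly by the digit sequence; excluding both readings makes the two counts agree.
  exceptionalValues : List ℕ
  exceptionalValues = map (λ i → digVal b g i t) wrappingStarts
                   ++ map (λ i → wordValue (subword L g i t)) wrappingStarts

  length-exceptionalValues : length exceptionalValues ≡ t + t
  length-exceptionalValues = begin
    length exceptionalValues
      ≡⟨ length-++ (map (λ i → digVal b g i t) wrappingStarts) ⟩
    length (map (λ i → digVal b g i t) wrappingStarts) + length (map (λ i → wordValue (subword L g i t)) wrappingStarts)
      ≡⟨ cong₂ _+_ (length-map-wrappingStarts _) (length-map-wrappingStarts _) ⟩
    t + t
      ∎
    where
      open ≡-Reasoning
      length-map-wrappingStarts : (f : ℕ → ℕ) → length (map f wrappingStarts) ≡ t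
      length-map-wrappingStarts f =
        trans (length-map f wrappingStarts) (trans (length-map (L ∸ t +_) (upTo t)) (length-upTo t))

  wordValue-subword : ∀ {i} → i + t ≤ L → wordValue (subword L g i t) ≡ digVal b g i t
  wordValue-subword {i} i+t≤L = begin
    wordValue (subword L g i t)                              ≡⟨ wordValue-tabulate {t = t} _ ⟩
    toℕ (funToFin (λ (r : Fin t) → g (wrap L (i + toℕ r))))  ≡⟨ cong toℕ (funToFin-cong inside) ⟩
    toℕ (funToFin (λ (r : Fin t) → g (i + toℕ r)))           ≡⟨ Digits.toℕ-funToFin-digits g i t ⟩
    digVal b g i t                                           ∎
    where
      open ≡-Reasoning
      inside : (r : Fin t) → g (wrap L (i + toℕ r)) ≡ g (i + toℕ r)
      inside r = cong g (wrap-< (≤-trans (+-monoʳ-< i (toℕ<n r)) i+t≤L))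

  window⇔ : ∀ {c} {u : Vec (Fin b) t} → c ∉ exceptionalValues → wordValue u ≡ c →
            ∀ {i} → i < L → digVal b g i t ≡ c ⇔ subword L g i t ≡ u
  window⇔ {c} {u} c∉ u↦c {i} i<L with i + t ≤? L
  ... | yes i+t≤L = mk⇔
        (λ i↦c → wordValue-injective (trans (wordValue-subword i+t≤L) (trans i↦c (sym u↦c))))
        (λ { refl → trans (sym (wordValue-subword i+t≤L)) u↦c })
  ... | no i+t≰L = mk⇔
        (λ { refl → ⊥-elim (c∉ (∈-++⁺ˡ (∈-map⁺ (λ i → digVal b g i t) wrapping))) })
        (λ { refl → ⊥-elim (c∉ (subst (_∈ exceptionalValues) u↦c
                      (∈-++⁺ʳ (map (λ i → digVal b g i t) wrappingStarts)
                              (∈-map⁺ (λ i → wordValue (subword L g i t)) wrapping)))) })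
    where
      wrapping : i ∈ wrappingStarts
      wrapping = ∈-wrappingStarts i<L (≰⇒> i+t≰L)

  windowCount : SemiPerfect b t l g → ∀ c → c < b ^ t → c ∉ exceptionalValues →
                length (filter (λ i → digVal b g i t ≟ c) (upTo L)) ≡ l
  windowCount semiPerfect c c< c∉ with u , u↦c ← wordValue-surjective {b} {t} c< =
    trans (cong length (filter-≐-∈ (λ i → digVal b g i t ≟ c) (λ i → ≡-dec _≟F_ (subword L g i t) u) (upTo L)
                                    (window⇔ c∉ u↦c ∘ ∈-upTo⁻)))
          (semiPerfect u)

module _ {b} (d : ℕ → Fin b)
         (nested : ∀ j → 1 ≤ j → NestedSemiPerfect b (b ^ j) (b ^ j) (λ i → d (nIdx b j + i))) where

  -- The first level-1 block of w_{M+1} is a semi-perfect necklace, and w_{M+1} starts past M.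
  digit-recurs : ∀ (a : Fin b) M → ∃ λ p → M ≤ p × d p ≡ a
  digit-recurs a M =
    let i , i↦a = SemiPerfect-occurs {f = block₁} (m^n>0 b j) level₁ (a ∷ [])
    in  nIdx b j + (0 * len₁ + wrap len₁ (i + 0)) , ≤-trans (M≤partialLen M) (m≤m+n _ _) , cong head i↦a
    where
      instance
        b-nonZero : NonZero b
        b-nonZero = nonZeroIndex a
      j = suc M
      len₁ = b ^ j * b ^ 1
      block₁ : ℕ → Fin b
      block₁ i = d (nIdx b j + (0 * len₁ + i))
      level₁ : SemiPerfect b 1 (b ^ j) block₁
      level₁ = nested j (s≤s z≤n) 1 ≤-refl (m^n>0 b j) 0
                 (≤-trans (≤-reflexive (*-identityˡ len₁)) (*-monoʳ-≤ (b ^ j) (^-monoʳ-≤ b (m^n>0 b j))))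
      M≤partialLen : ∀ M → M ≤ partialLen b M
      M≤partialLen zero = z≤n
      M≤partialLen (suc M) = subst (_≤ partialLen b (suc M)) (+-comm M 1)
        (+-mono-≤ (M≤partialLen M)
                  (>-nonZero⁻¹ (lenW b (suc M)) {{m*n≢0 (b ^ suc M) (b ^ (b ^ suc M)) {{m^n≢0 b (suc M)}} {{m^n≢0 b (b ^ suc M)}}}}))

  nonMaximalDigitsRecur : 2 ≤ b → Digits.NonMaximalDigitsRecur d
  nonMaximalDigitsRecur 2≤b M =
    let p , M≤p , p↦0 = digit-recurs zero-digit M
    in  p , M≤p , subst (λ a → suc (toℕ a) < b) (sym p↦0) (subst (λ z → suc z < b) (sym (toℕ-fromℕ< 0<b)) 2≤b)
    where
      0<b : 0 < b
      0<b = ≤-trans (s≤s z≤n) 2≤b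
      zero-digit : Fin b
      zero-digit = fromℕ< 0<b

module _ (l : ℕ) .{{_ : NonZero l}} (O : ℕ) where

  splitIndex : ℕ → ℕ × ℕ
  splitIndex i = i % l , O + i / l

  splitIndex-injective : Injective _≡_ _≡_ splitIndex
  splitIndex-injective {i} {j} eq = begin
    i                  ≡⟨ m≡m%n+[m/n]*n i l ⟩
    i % l + i / l * l  ≡⟨ cong₂ (λ r q → r + q * l) (cong proj₁ eq) (+-cancelˡ-≡ O _ _ (cong proj₂ eq)) ⟩
    j % l + j / l * l  ≡⟨ m≡m%n+[m/n]*n j l ⟨
    j                  ∎
    where open ≡-Reasoning

  splitIndex-range : ∀ T k n → (k < l × O ≤ n × n < O + T) ⇔ ∃ λ i → i < l * T × splitIndex i ≡ (k , n)
  splitIndex-range T k n = mk⇔ to from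
    where
      to : k < l × O ≤ n × n < O + T → ∃ λ i → i < l * T × splitIndex i ≡ (k , n)
      to (k<l , O≤n , n<O+T) with a , refl ← m≤n⇒∃[o]m+o≡n O≤n =
        a * l + k , subst (a * l + k <_) (*-comm T l) (m*o+r<n*o (+-cancelˡ-< O a T n<O+T) k<l) ,
        cong₂ _,_ remainder (cong (O +_) quotient)
        where
          remainder : (a * l + k) % l ≡ k
          remainder = trans (cong (_% l) (+-comm (a * l) k)) (trans ([m+kn]%n≡m%n k a l) (m<n⇒m%n≡m k<l))
          quotient : (a * l + k) / l ≡ a
          quotient = *-cancelʳ-≡ _ a l (+-cancelˡ-≡ k _ _ (begin
            k + (a * l + k) / l * l                ≡⟨ cong (_+ (a * l + k) / l * l) remainder ⟨
            (a * l + k) % l + (a * l + k) / l * l  ≡⟨ m≡m%n+[m/n]*n (a * l + k) l ⟨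
            a * l + k                              ≡⟨ +-comm (a * l) k ⟩
            k + a * l                              ∎))
            where open ≡-Reasoning
      from : (∃ λ i → i < l * T × splitIndex i ≡ (k , n)) → k < l × O ≤ n × n < O + T
      from (i , i<lT , refl) =
        m%n<n i l , m≤m+n O (i / l) , +-monoʳ-< O (m<n*o⇒m/o<n (subst (i <_) (*-comm l T) i<lT))

block-fits : ∀ {b} l t k B → t ≤ k → B < b ^ (k ∸ t) → suc B * (l * b ^ t) ≤ l * b ^ k
block-fits {b} l t k B t≤k B< = begin
  suc B * (l * b ^ t)        ≡⟨ x*[y*z]≡y*[x*z] (suc B) l (b ^ t) ⟩
  l * (suc B * b ^ t)        ≤⟨ *-monoʳ-≤ l (*-monoˡ-≤ (b ^ t) B<) ⟩
  l * (b ^ (k ∸ t) * b ^ t)  ≡⟨ cong (l *_) (^-distribˡ-+-* b (k ∸ t) t) ⟨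
  l * b ^ (k ∸ t + t)        ≡⟨ cong (λ e → l * b ^ e) (m∸n+n≡m t≤k) ⟩
  l * b ^ k                  ∎
  where
    open ≤-Reasoning
    x*[y*z]≡y*[x*z] : ∀ x y z → x * (y * z) ≡ y * (x * z)
    x*[y*z]≡y*[x*z] = solve-∀

module BlockCount {b} (d : ℕ → Fin b) (recur : Digits.NonMaximalDigitsRecur d)
                  (N₀ l t B : ℕ) .{{_ : NonZero l}} where

  T L : ℕ
  T = b ^ t
  L = l * T

  block : ℕ → Fin b
  block i = d (N₀ + (B * L + i))

  position : ∀ {i k n} → splitIndex l (B * T) i ≡ (k , n) → N₀ + l * n + k ≡ N₀ + B * L + i
  position {i} refl = begin
    N₀ + l * (B * T + i / l) + i % l  ≡⟨ rearrange N₀ l B T (i / l) (i % l) ⟩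
    N₀ + B * L + (i % l + i / l * l)  ≡⟨ cong (N₀ + B * L +_) (m≡m%n+[m/n]*n i l) ⟨
    N₀ + B * L + i                    ∎
    where
      open ≡-Reasoning
      rearrange : ∀ N₀ l B T q r → N₀ + l * (B * T + q) + r ≡ N₀ + B * (l * T) + (r + q * l)
      rearrange = solve-∀

  cell⇔ : ∀ c k n → (k < l × B * T ≤ n × n < B * T + T × InInterval b d (N₀ + l * n + k) t c)
                    ⇔ ∃ λ i → i < L × digVal b block i t ≡ c × splitIndex l (B * T) i ≡ (k , n)
  cell⇔ c k n = mk⇔ to from
    where
      open Digits d using (digVal-shift; InInterval⇔digVal≡)
      block↦c⇔ : ∀ {i} → splitIndex l (B * T) i ≡ (k , n) →
                 InInterval b d (N₀ + l * n + k) t c ⇔ digVal b block i t ≡ c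
      block↦c⇔ {i} split = mk⇔
        (λ inInterval → trans same-digits (Equivalence.to interval⇔ inInterval))
        (λ block↦c → Equivalence.from interval⇔ (trans (sym same-digits) block↦c))
        where
          interval⇔ = InInterval⇔digVal≡ recur (N₀ + l * n + k) t c
          same-digits : digVal b block i t ≡ digVal b d (N₀ + l * n + k) t
          same-digits = trans (digVal-shift (N₀ + B * L) (λ j → cong d (sym (+-assoc N₀ (B * L) j))) i t)
                              (cong (λ p → digVal b d p t) (sym (position split)))
      to : k < l × B * T ≤ n × n < B * T + T × InInterval b d (N₀ + l * n + k) t c →
           ∃ λ i → i < L × digVal b block i t ≡ c × splitIndex l (B * T) i ≡ (k , n)
      to (k<l , O≤n , n<O+T , inInterval)
        with i , i<L , split ← Equivalence.to (splitIndex-range l (B * T) T k n) (k<l , O≤n , n<O+T) =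
        i , i<L , Equivalence.to (block↦c⇔ split) inInterval , split
      from : (∃ λ i → i < L × digVal b block i t ≡ c × splitIndex l (B * T) i ≡ (k , n)) →
             k < l × B * T ≤ n × n < B * T + T × InInterval b d (N₀ + l * n + k) t c
      from (i , i<L , block↦c , split) =
        let k<l , O≤n , n<O+T = Equivalence.from (splitIndex-range l (B * T) T k n) (i , i<L , split)
        in  k<l , O≤n , n<O+T , Equivalence.from (block↦c⇔ split) block↦c

lemma1 : (b : ℕ) → 2 ≤ b → (d : ℕ → Fin b) →
    (∀ j → 1 ≤ j → NestedSemiPerfect b (b ^ j) (b ^ j) (λ i → d (nIdx b j + i))) →
    ∀ m → 1 ≤ m → ∀ t → 1 ≤ t → t ≤ b ^ m → ∀ B → B < b ^ (b ^ m ∸ t) →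
    Σ (List ℕ) λ E → length E ≤ 2 * b ^ m ×
      (∀ c → c < b ^ t → c ∉ E →
        HasCard (λ { (k , n) → k < b ^ m × B * b ^ t ≤ n × n < B * b ^ t + b ^ t ×
                     InInterval b d (nIdx b m + b ^ m * n + k) t c })
                (b ^ m))
lemma1 b 2≤b d nested m 1≤m t 1≤t t≤bᵐ B B< =
  exceptionalValues , length≤ ,
  λ c c< c∉ → subst (HasCard _) (windowCount semiPerfect c c< c∉)
    (HasCard-map-filter (λ i → digVal b block i t ≟ c) (splitIndex-injective (b ^ m) (B * b ^ t)) L
                        (λ { (k , n) → cell⇔ c k n }))
  where
    instance
      bᵐ-nonZero : NonZero (b ^ m)
      bᵐ-nonZero = m^n≢0 b m {{>-nonZero (≤-trans (s≤s z≤n) 2≤b)}}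
    open BlockCount d (nonMaximalDigitsRecur d nested 2≤b) (nIdx b m) (b ^ m) t B
    open Windows block t (b ^ m)
    semiPerfect : SemiPerfect b t (b ^ m) block
    semiPerfect = nested m 1≤m t 1≤t t≤bᵐ B (block-fits (b ^ m) t (b ^ m) B t≤bᵐ B<)
    length≤ : length exceptionalValues ≤ 2 * b ^ m
    length≤ = subst (_≤ 2 * b ^ m) (sym length-exceptionalValues)
                    (+-mono-≤ t≤bᵐ (≤-trans t≤bᵐ (m≤m+n (b ^ m) 0)))
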